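{- Let $L$ be a residuated lattice and $n\geq 1$ an integer. The following conditions are equivalent: (i) $L$ is an $n$-fold fantastic residuated lattice; (ii) every filter of $L$ is an $n$-fold fantastic filter of $L$; (iii) $\{1\}$ is an $n$-fold fantastic filter of $L$.
   Context: A residuated lattice is an algebra $(L,\wedge,\vee,\otimes,\rightarrow,0,1)$ such that $(L,\wedge,\vee,0,1)$ is a bounded lattice, $(L,\otimes,1)$ is a commutative monoid, and $x\otimes y\leq z$ iff $x\leq y\rightarrow z$. A filter of $L$ is a nonempty subset closed under $\otimes$ and upward closed. For $x\in L$, $x^n=x\otimes\cdots\otimes x$ ($n$ factors). $L$ is an $n$-fold fantastic residuated lattice if $y\rightarrow x=((x^n\rightarrow y)\rightarrow y)\rightarrow x$ for all $x,y\in L$. A subset $F\subseteq L$ is an $n$-fold fantastic filter if $1\in F$ and for all $x,y\in L$: $y\rightarrow x\in F$ implies $((x^n\rightarrow y)\rightarrow y)\rightarrow x\in F$. -}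

module Defs where

open import Level using (Level; suc; _⊔_)
open import Data.Nat using (ℕ; zero) renaming (suc to sucℕ)
open import Data.Product using (Σ; _×_; ∃)
open import Relation.Binary.PropositionalEquality using (_≡_)
open import Algebra.Lattice.Structures using (IsLattice)
open import Algebra.Structures using (IsCommutativeMonoid)
open import Function.Bundles using (_⇔_)

record ResiduatedLattice (a : Level) : Set (suc a) where
  infixr 7 _⊗_
  infixr 5 _⇒_
  infixr 6 _∧_ _∨_
  infix 4 _≤_
  field
    Carrier : Set a
    _∧_ _∨_ _⊗_ _⇒_ : Carrier → Carrier → Carrier
    𝟎 𝟏 : Carrier
    isLattice : IsLattice _≡_ _∨_ _∧_
    isCommutativeMonoid : IsCommutativeMonoid _≡_ _⊗_ 𝟏

  _≤_ : Carrier → Carrier → Set a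
  x ≤ y = x ∧ y ≡ x

  field
    𝟎-least : ∀ x → 𝟎 ≤ x
    𝟏-greatest : ∀ x → x ≤ 𝟏
    residuation : ∀ x y z → (x ⊗ y ≤ z) ⇔ (x ≤ y ⇒ z)

module _ {a : Level} (L : ResiduatedLattice a) where
  open ResiduatedLattice L

  pow : Carrier → ℕ → Carrier
  pow x zero = 𝟏
  pow x (sucℕ n) = x ⊗ pow x n

  Subset : (ℓ : Level) → Set (a ⊔ suc ℓ)
  Subset ℓ = Carrier → Set ℓ

  IsFilter : {ℓ : Level} → Subset ℓ → Set (a ⊔ ℓ)
  IsFilter F =
    (∃ λ x → F x) ×
    (∀ x y → F x → F y → F (x ⊗ y)) ×
    (∀ x y → x ≤ y → F x → F y)

  IsNFoldFantasticLattice : ℕ → Set a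
  IsNFoldFantasticLattice n =
    ∀ x y → (y ⇒ x) ≡ (((pow x n ⇒ y) ⇒ y) ⇒ x)

  IsNFoldFantasticFilter : {ℓ : Level} → ℕ → Subset ℓ → Set (a ⊔ ℓ)
  IsNFoldFantasticFilter n F =
    F 𝟏 × (∀ x y → F (y ⇒ x) → F (((pow x n ⇒ y) ⇒ y) ⇒ x))

  singleton𝟏 : Subset a
  singleton𝟏 x = x ≡ 𝟏

-- The condition on {1} says exactly: y ≤ x implies (xⁿ → y) → y ≤ x.  Since
-- y ≤ (xⁿ → y) → y always, the inequality ((xⁿ → y) → y) → x ≤ y → x holds in
-- every residuated lattice.  For the converse, apply the condition to the pair
-- y ≤ (y → x) → x: monotonicity of powers and antitonicity of → in its first
-- argument give (xⁿ → y) → y ≤ (y → x) → x, which by residuation is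
-- y → x ≤ ((xⁿ → y) → y) → x.
module Submission where

open import Defs
open import Level using (Level)
open import Data.Nat using (ℕ; _≥_; zero) renaming (suc to sucℕ)
open import Data.Product using (_×_; _,_)
open import Function.Base using (_∘_)
open import Function.Bundles using (_⇔_; mk⇔; Equivalence)
open import Relation.Binary.PropositionalEquality
open import Algebra.Lattice.Bundles using (Lattice)
open import Algebra.Structures using (IsCommutativeMonoid)
import Algebra.Lattice.Properties.Lattice as LatticeProperties
import Algebra.Lattice.Properties.Semilattice as SemilatticeProperties
open import Relation.Binary.Bundles using (Poset)

module ResiduatedLatticeProperties {a : Level} (L : ResiduatedLattice a) where
  open ResiduatedLattice L
  open IsCommutativeMonoid isCommutativeMonoid
    using () renaming (comm to ⊗-comm; identityˡ to ⊗-identityˡ; identityʳ to ⊗-identityʳ)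

  private
    lattice : Lattice a a
    lattice = record { isLattice = isLattice }

    open LatticeProperties lattice using (∧-semilattice)
    -- The library's natural order is x ≡ x ∧ y, the symmetric form of _≤_.
    open Poset (SemilatticeProperties.poset ∧-semilattice)
      using () renaming (refl to ∧-refl; trans to ∧-trans; antisym to ∧-antisym)

  ≤-refl : ∀ {x} → x ≤ x
  ≤-refl = sym ∧-refl

  ≤-trans : ∀ {x y z} → x ≤ y → y ≤ z → x ≤ z
  ≤-trans p q = sym (∧-trans (sym p) (sym q))

  ≤-antisym : ∀ {x y} → x ≤ y → y ≤ x → x ≡ y
  ≤-antisym p q = ∧-antisym (sym p) (sym q)

  ≤-reflexive : ∀ {x y} → x ≡ y → x ≤ y
  ≤-reflexive refl = ≤-refl

  curry-≤ : ∀ {x y z} → x ⊗ y ≤ z → x ≤ y ⇒ z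
  curry-≤ {x} {y} {z} = Equivalence.to (residuation x y z)

  uncurry-≤ : ∀ {x y z} → x ≤ y ⇒ z → x ⊗ y ≤ z
  uncurry-≤ {x} {y} {z} = Equivalence.from (residuation x y z)

  ⇒-eval : ∀ {x y} → (x ⇒ y) ⊗ x ≤ y
  ⇒-eval = uncurry-≤ ≤-refl

  ⊗-monoˡ-≤ : ∀ {x y} z → x ≤ y → x ⊗ z ≤ y ⊗ z
  ⊗-monoˡ-≤ z x≤y = uncurry-≤ (≤-trans x≤y (curry-≤ ≤-refl))

  ⊗-monoʳ-≤ : ∀ {x y} z → x ≤ y → z ⊗ x ≤ z ⊗ y
  ⊗-monoʳ-≤ {x} {y} z x≤y =
    ≤-trans (≤-reflexive (⊗-comm z x)) (≤-trans (⊗-monoˡ-≤ z x≤y) (≤-reflexive (⊗-comm y z)))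

  ⇒-antitoneˡ-≤ : ∀ {x y} z → x ≤ y → y ⇒ z ≤ x ⇒ z
  ⇒-antitoneˡ-≤ {x} {y} z x≤y = curry-≤ (≤-trans (⊗-monoʳ-≤ (y ⇒ z) x≤y) ⇒-eval)

  pow-mono-≤ : ∀ {x y} n → x ≤ y → pow L x n ≤ pow L y n
  pow-mono-≤ zero x≤y = ≤-refl
  pow-mono-≤ {x} {y} (sucℕ n) x≤y =
    ≤-trans (⊗-monoˡ-≤ (pow L x n) x≤y) (⊗-monoʳ-≤ y (pow-mono-≤ n x≤y))

  x≤y⇒x : ∀ x y → x ≤ y ⇒ x
  x≤y⇒x x y = curry-≤ (≤-trans (⊗-monoʳ-≤ x (𝟏-greatest y)) (≤-reflexive (⊗-identityʳ x)))

  x≤[x⇒y]⇒y : ∀ x y → x ≤ (x ⇒ y) ⇒ y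
  x≤[x⇒y]⇒y x y = curry-≤ (≤-trans (≤-reflexive (⊗-comm x (x ⇒ y))) ⇒-eval)

  ⇒≡𝟏⇒≤ : ∀ {x y} → x ⇒ y ≡ 𝟏 → x ≤ y
  ⇒≡𝟏⇒≤ {x} x⇒y≡𝟏 =
    ≤-trans (≤-reflexive (sym (⊗-identityˡ x))) (uncurry-≤ (≤-reflexive (sym x⇒y≡𝟏)))

  ≤⇒⇒≡𝟏 : ∀ {x y} → x ≤ y → x ⇒ y ≡ 𝟏
  ≤⇒⇒≡𝟏 {x} x≤y =
    ≤-antisym (𝟏-greatest _) (curry-≤ (≤-trans (≤-reflexive (⊗-identityˡ x)) x≤y))

  𝟏≤⇒≡𝟏 : ∀ {x} → 𝟏 ≤ x → x ≡ 𝟏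
  𝟏≤⇒≡𝟏 {x} = ≤-antisym (𝟏-greatest x)

  filter-𝟏 : ∀ {ℓ} {F : Subset L ℓ} → IsFilter L F → F 𝟏
  filter-𝟏 ((x , Fx) , _ , upward) = upward x 𝟏 (𝟏-greatest x) Fx

  singleton𝟏-isFilter : IsFilter L (singleton𝟏 L)
  singleton𝟏-isFilter =
    (𝟏 , refl) ,
    (λ x y x≡𝟏 y≡𝟏 → trans (cong₂ _⊗_ x≡𝟏 y≡𝟏) (⊗-identityˡ 𝟏)) ,
    (λ x y x≤y x≡𝟏 → 𝟏≤⇒≡𝟏 (subst (_≤ y) x≡𝟏 x≤y))

  module _ (n : ℕ) where

    fantastic⇒≤⇒ : ∀ x y → ((pow L x n ⇒ y) ⇒ y) ⇒ x ≤ y ⇒ x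
    fantastic⇒≤⇒ x y = ⇒-antitoneˡ-≤ x (x≤y⇒x y (pow L x n ⇒ y))

    singleton𝟏-fantastic⇒≤ : IsNFoldFantasticFilter L n (singleton𝟏 L) →
                             ∀ {x y} → y ≤ x → (pow L x n ⇒ y) ⇒ y ≤ x
    singleton𝟏-fantastic⇒≤ (_ , fantastic) {x} {y} y≤x =
      ⇒≡𝟏⇒≤ (fantastic x y (≤⇒⇒≡𝟏 y≤x))

    ⇒≤fantastic⇒ : IsNFoldFantasticFilter L n (singleton𝟏 L) →
                   ∀ x y → y ⇒ x ≤ ((pow L x n ⇒ y) ⇒ y) ⇒ x
    ⇒≤fantastic⇒ singleton𝟏-fantastic x y =
      curry-≤ (≤-trans (≤-reflexive (⊗-comm (y ⇒ x) w)) (uncurry-≤ w≤[y⇒x]⇒x))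
      where
      w : Carrier
      w = (pow L x n ⇒ y) ⇒ y

      w≤[y⇒x]⇒x : w ≤ (y ⇒ x) ⇒ x
      w≤[y⇒x]⇒x =
        ≤-trans (⇒-antitoneˡ-≤ y (⇒-antitoneˡ-≤ y (pow-mono-≤ n (x≤y⇒x x (y ⇒ x)))))
                (singleton𝟏-fantastic⇒≤ singleton𝟏-fantastic (x≤[x⇒y]⇒y y x))

    fantasticLattice⇒fantasticFilters :
      IsNFoldFantasticLattice L n →
      ∀ (F : Subset L a) → IsFilter L F → IsNFoldFantasticFilter L n F
    fantasticLattice⇒fantasticFilters fantastic F isFilter =
      filter-𝟏 isFilter , λ x y → subst F (fantastic x y)

    fantasticFilters⇒singleton𝟏-fantastic :
      (∀ (F : Subset L a) → IsFilter L F → IsNFoldFantasticFilter L n F) →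
      IsNFoldFantasticFilter L n (singleton𝟏 L)
    fantasticFilters⇒singleton𝟏-fantastic all-fantastic =
      all-fantastic (singleton𝟏 L) singleton𝟏-isFilter

    singleton𝟏-fantastic⇒fantasticLattice :
      IsNFoldFantasticFilter L n (singleton𝟏 L) → IsNFoldFantasticLattice L n
    singleton𝟏-fantastic⇒fantasticLattice singleton𝟏-fantastic x y =
      ≤-antisym (⇒≤fantastic⇒ singleton𝟏-fantastic x y) (fantastic⇒≤⇒ x y)

proposition7p12 : {a : Level} (L : ResiduatedLattice a) (n : ℕ) → n ≥ 1 →
    (IsNFoldFantasticLattice L n ⇔ (∀ (F : Subset L a) → IsFilter L F → IsNFoldFantasticFilter L n F)) ×
    ((∀ (F : Subset L a) → IsFilter L F → IsNFoldFantasticFilter L n F) ⇔ IsNFoldFantasticFilter L n (singleton𝟏 L))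
proposition7p12 L n _ =
  mk⇔ (fantasticLattice⇒fantasticFilters n)
      (singleton𝟏-fantastic⇒fantasticLattice n ∘ fantasticFilters⇒singleton𝟏-fantastic n) ,
  mk⇔ (fantasticFilters⇒singleton𝟏-fantastic n)
      (fantasticLattice⇒fantasticFilters n ∘ singleton𝟏-fantastic⇒fantasticLattice n)
  where open ResiduatedLatticeProperties L
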